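{- If $I(G, G_f, s, t, k)$ is a Yes-instance then $|H| \leq k$ and $G_f[R]$ has at most $ k^2$ edges.
   Context: $I(G,G_f,s,t,k)$ is an instance of Shortest Path with Forcing Graph: $G=(V,E)$ is a simple undirected graph, $s,t\in V(G)$ distinct, $k$ a positive integer, and $G_f=(E,E')$ a forcing graph whose vertex set is $E(G)$; it is a Yes-instance if there is $E^*\subseteq E$ with $|E^*|\le k$ such that $(V,E^*)$ contains an $s$-$t$ path and $E^*$ is a vertex cover of $G_f$. Partition $E(G)=V(G_f)$ as follows: an edge $e\in E(G)$ is in $H$ if $\deg_{G_f}(e)\ge k+1$; $e$ is in $L$ if $N_{G_f}(e)\subseteq H$ (in particular every isolated vertex of $G_f$ is in $L$); and $R=E(G)\setminus(H\cup L)$. -}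

module Defs where

open import Data.Nat using (ℕ; _<ᵇ_; _≤_; _<_)
open import Data.Fin using (Fin)
import Data.Fin as F
open import Data.Fin.Subset using (Subset; _∈_; ∣_∣)
open import Data.Bool using (Bool; true; false; T; _∧_; _∨_; not)
import Data.Bool
open import Data.List using (List; []; _∷_; length; filterᵇ; allFin; cartesianProduct)
open import Data.List.Relation.Unary.Unique.Propositional using (Unique)
open import Data.Product using (_×_; _,_; proj₁; proj₂; Σ; ∃)
open import Data.Sum using (_⊎_)
open import Relation.Binary.PropositionalEquality using (_≡_; _≢_)

record SimpleGraph (n m : ℕ) : Set where
  field
    ends     : Fin m → Fin n × Fin n
    noLoop   : ∀ e → proj₁ (ends e) ≢ proj₂ (ends e)
    noMulti  : ∀ e f → (ends e ≡ ends f ⊎ ends e ≡ (proj₂ (ends f) , proj₁ (ends f))) → e ≡ f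

Joins : ∀ {n m} → SimpleGraph n m → Fin m → Fin n → Fin n → Set
Joins G e u v = SimpleGraph.ends G e ≡ (u , v) ⊎ SimpleGraph.ends G e ≡ (v , u)

-- The forcing graph G_f: a simple undirected graph whose vertex set is E(G) = Fin m,
-- given by a symmetric irreflexive Boolean adjacency relation.
record ForcingGraph (m : ℕ) : Set where
  field
    adj      : Fin m → Fin m → Bool
    symm     : ∀ e f → adj e f ≡ adj f e
    irrefl   : ∀ e → adj e e ≡ false

data Walk {n m} (G : SimpleGraph n m) (E* : Subset m) : Fin n → Fin n → Set where
  stop : ∀ {u} → Walk G E* u u
  step : ∀ {u v w} (e : Fin m) → e ∈ E* → Joins G e u v → Walk G E* v w → Walk G E* u w

verts : ∀ {n m} {G : SimpleGraph n m} {E* : Subset m} {u v} → Walk G E* u v → List (Fin n)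
verts {u = u} stop = u ∷ []
verts {u = u} (step e _ _ w) = u ∷ verts w

HasPath : ∀ {n m} → SimpleGraph n m → Subset m → Fin n → Fin n → Set
HasPath G E* s t = Σ (Walk G E* s t) λ w → Unique (verts w)

VertexCover : ∀ {m} → ForcingGraph m → Subset m → Set
VertexCover Gf E* = ∀ e f → T (ForcingGraph.adj Gf e f) → e ∈ E* ⊎ f ∈ E*

YesInstance : ∀ {n m} → SimpleGraph n m → ForcingGraph m → Fin n → Fin n → ℕ → Set
YesInstance {m = m} G Gf s t k =
  ∃ λ (E* : Subset m) → ∣ E* ∣ ≤ k × HasPath G E* s t × VertexCover Gf E*

deg : ∀ {m} → ForcingGraph m → Fin m → ℕ
deg {m} Gf e = length (filterᵇ (ForcingGraph.adj Gf e) (allFin m))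

inH : ∀ {m} → ForcingGraph m → ℕ → Fin m → Bool
inH Gf k e = k <ᵇ deg Gf e

allᵇ : ∀ {A : Set} → (A → Bool) → List A → Bool
allᵇ p [] = true
allᵇ p (x ∷ xs) = p x ∧ allᵇ p xs

-- e ∈ L  iff  N(e) ⊆ H  (includes isolated vertices of G_f).
inL : ∀ {m} → ForcingGraph m → ℕ → Fin m → Bool
inL {m} Gf k e = allᵇ (λ f → not (ForcingGraph.adj Gf e f) Data.Bool.∨ inH Gf k f) (allFin m)

inR : ∀ {m} → ForcingGraph m → ℕ → Fin m → Bool
inR Gf k e = not (inH Gf k e) ∧ not (inL Gf k e)

sizeH : ∀ {m} → ForcingGraph m → ℕ → ℕ
sizeH {m} Gf k = length (filterᵇ (inH Gf k) (allFin m))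

edgesR : ∀ {m} → ForcingGraph m → ℕ → ℕ
edgesR {m} Gf k = length (filterᵇ isEdge (cartesianProduct (allFin m) (allFin m)))
  where
  isEdge : Fin m × Fin m → Bool
  isEdge (e , f) = (F.toℕ e <ᵇ F.toℕ f) ∧ inR Gf k e ∧ inR Gf k f ∧ ForcingGraph.adj Gf e f

{-# OPTIONS --safe #-}
-- A vertex cover C with |C| ≤ k must contain every vertex of degree > k
-- (otherwise all of its more than k neighbours would lie in C), so H ⊆ C.
-- Every edge of G_f[R] has an endpoint in C ∩ R, and vertices of R have
-- degree at most k; charging each edge to such an endpoint gives at most
-- |C| · k ≤ k² edges.
module Submission where

open import Defs
open import Data.Nat using (ℕ; zero; suc; _≤_; _<_; _*_; _+_; _<ᵇ_; z≤n; s≤s)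
open import Data.Nat.Properties
open import Data.Fin using (Fin; toℕ; zero; suc)
open import Data.Fin.Subset using (Subset; ∣_∣)
open import Data.Bool using (Bool; true; false; T; _∧_)
open import Data.Empty using (⊥; ⊥-elim)
open import Data.List using (length; _++_; filterᵇ; allFin; tabulate; map; cartesianProduct)
open import Data.List.Properties using (length-++; filter-++; map-tabulate)
open import Data.Product using (_×_; _,_)
open import Data.Sum using (_⊎_; inj₁; inj₂)
open import Data.Unit using (tt)
open import Data.Vec using (lookup) renaming (_∷_ to _∷ᵥ_; [] to []ᵥ)
open import Data.Vec.Properties using ([]=⇒lookup)
open import Function using (_∘_)
open import Relation.Nullary using (¬_; yes; no)
open import Relation.Nullary.Decidable using (T?)
open import Relation.Binary.PropositionalEquality using (_≡_; _≢_; refl; sym; trans; cong; cong₂; subst; module ≡-Reasoning)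
open import Algebra.Properties.Semiring.Sum +-*-semiring
  using (sum; sum-syntax; sum-cong-≗; ∑-distrib-+; ∑-comm; *-distribʳ-sum; sum-replicate-zero)

χ : Bool → ℕ
χ true  = 1
χ false = 0

χ-mono : ∀ {a b} → (T a → T b) → χ a ≤ χ b
χ-mono {false}         _ = z≤n
χ-mono {true}  {true}  _ = ≤-refl
χ-mono {true}  {false} h = ⊥-elim (h tt)

χ-*-≤ : ∀ {b n d} → (T b → n ≤ d) → χ b * n ≤ d
χ-*-≤ {false} _ = z≤n
χ-*-≤ {true}  h = ≤-trans (≤-reflexive (+-identityʳ _)) (h tt)

χ-∧-disjoint : ∀ {l₁ l₂} b → (T l₁ → T l₂ → ⊥) → χ (l₁ ∧ b) + χ (l₂ ∧ b) ≤ χ b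
χ-∧-disjoint {false} {false} _     _ = z≤n
χ-∧-disjoint {false} {true}  b     _ = ≤-refl
χ-∧-disjoint {true}  {false} b     _ = ≤-reflexive (+-identityʳ (χ b))
χ-∧-disjoint {true}  {true}  _     h = ⊥-elim (h tt tt)

sum-mono-≤ : ∀ {n} {f g : Fin n → ℕ} → (∀ i → f i ≤ g i) → sum f ≤ sum g
sum-mono-≤ {zero}  _ = z≤n
sum-mono-≤ {suc n} h = +-mono-≤ (h zero) (sum-mono-≤ (h ∘ suc))

∑-χ-∧ : ∀ {n} b (g : Fin n → Bool) → ∑[ j < n ] χ (b ∧ g j) ≡ χ b * ∑[ j < n ] χ (g j)
∑-χ-∧ {n} false g = sum-replicate-zero n
∑-χ-∧     true  g = sym (+-identityʳ _)

length-filterᵇ-tabulate : ∀ {A : Set} {n} (p : A → Bool) (f : Fin n → A) →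
                          length (filterᵇ p (tabulate f)) ≡ ∑[ i < n ] χ (p (f i))
length-filterᵇ-tabulate {n = zero}  p f = refl
length-filterᵇ-tabulate {n = suc n} p f with p (f zero)
... | true  = cong suc (length-filterᵇ-tabulate p (f ∘ suc))
... | false = length-filterᵇ-tabulate p (f ∘ suc)

length-filterᵇ-cartesianProduct :
  ∀ {A B : Set} {m n} (p : A × B → Bool) (f : Fin m → A) (g : Fin n → B) →
  length (filterᵇ p (cartesianProduct (tabulate f) (tabulate g)))
    ≡ ∑[ i < m ] ∑[ j < n ] χ (p (f i , g j))
length-filterᵇ-cartesianProduct {m = zero}  p f g = refl
length-filterᵇ-cartesianProduct {m = suc m} {n} p f g = begin
  length (filterᵇ p (row ++ rest))                      ≡⟨ cong length (filter-++ (T? ∘ p) row rest) ⟩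
  length (filterᵇ p row ++ filterᵇ p rest)              ≡⟨ length-++ (filterᵇ p row) ⟩
  length (filterᵇ p row) + length (filterᵇ p rest)      ≡⟨ cong₂ _+_ first-row (length-filterᵇ-cartesianProduct p (f ∘ suc) g) ⟩
  ∑[ j < n ] χ (p (f zero , g j)) + ∑[ i < m ] ∑[ j < n ] χ (p (f (suc i) , g j)) ∎
  where
  open ≡-Reasoning
  row  = map (f zero ,_) (tabulate g)
  rest = cartesianProduct (tabulate (f ∘ suc)) (tabulate g)
  first-row : length (filterᵇ p row) ≡ ∑[ j < n ] χ (p (f zero , g j))
  first-row = trans (cong (length ∘ filterᵇ p) (map-tabulate g (f zero ,_)))
                    (length-filterᵇ-tabulate p ((f zero ,_) ∘ g))

∣∣≡∑χ : ∀ {m} (C : Subset m) → ∣ C ∣ ≡ ∑[ i < m ] χ (lookup C i)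
∣∣≡∑χ []ᵥ          = refl
∣∣≡∑χ (true  ∷ᵥ C) = cong suc (∣∣≡∑χ C)
∣∣≡∑χ (false ∷ᵥ C) = ∣∣≡∑χ C

χ-charge : ∀ l p q {a c₁ c₂} → (T a → T c₁ ⊎ T c₂) →
           χ (l ∧ p ∧ q ∧ a) ≤ χ (l ∧ c₁ ∧ p ∧ a) + χ (l ∧ c₂ ∧ q ∧ a)
χ-charge false _     _     _ = z≤n
χ-charge true  false _     _ = z≤n
χ-charge true  true  false _ = z≤n
χ-charge true  true  true {false}                _ = z≤n
χ-charge true  true  true {true} {true}          _ = s≤s z≤n
χ-charge true  true  true {true} {false} {true}  _ = s≤s z≤n
χ-charge true  true  true {true} {false} {false} h with h tt
... | inj₁ ()
... | inj₂ ()

isEdgeWithin : ∀ {m} → ForcingGraph m → (Fin m → Bool) → Fin m × Fin m → Bool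
isEdgeWithin Gf P (e , f) = (toℕ e <ᵇ toℕ f) ∧ P e ∧ P f ∧ ForcingGraph.adj Gf e f

edgesWithin : ∀ {m} → ForcingGraph m → (Fin m → Bool) → ℕ
edgesWithin {m} Gf P = length (filterᵇ (isEdgeWithin Gf P) (cartesianProduct (allFin m) (allFin m)))

inR⇒deg≤ : ∀ {m} (Gf : ForcingGraph m) k e → T (inR Gf k e) → deg Gf e ≤ k
inR⇒deg≤ Gf k e e∈R with inH Gf k e in e∈H
... | true  = ⊥-elim e∈R
... | false = ≮⇒≥ (λ k<deg → subst T e∈H (<⇒<ᵇ k<deg))

module _ {m} (Gf : ForcingGraph m) {C : Subset m} (cover : VertexCover Gf C) where
  open ForcingGraph Gf

  covered : Fin m → Bool
  covered = lookup C

  adj⇒covered⊎covered : ∀ e f → T (adj e f) → T (covered e) ⊎ T (covered f)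
  adj⇒covered⊎covered e f a with cover e f a
  ... | inj₁ e∈C = inj₁ (subst T (sym ([]=⇒lookup e∈C)) tt)
  ... | inj₂ f∈C = inj₂ (subst T (sym ([]=⇒lookup f∈C)) tt)

  deg≡∑χ : ∀ e → deg Gf e ≡ ∑[ f < m ] χ (adj e f)
  deg≡∑χ e = length-filterᵇ-tabulate (adj e) (λ f → f)

  deg≤∣C∣ : ∀ {e} → ¬ T (covered e) → deg Gf e ≤ ∣ C ∣
  deg≤∣C∣ {e} e∉C = begin
    deg Gf e                      ≡⟨ deg≡∑χ e ⟩
    ∑[ f < m ] χ (adj e f)        ≤⟨ sum-mono-≤ (λ f → χ-mono (neighbour-covered f)) ⟩
    ∑[ f < m ] χ (covered f)      ≡⟨ sym (∣∣≡∑χ C) ⟩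
    ∣ C ∣                         ∎
    where
    open ≤-Reasoning
    neighbour-covered : ∀ f → T (adj e f) → T (covered f)
    neighbour-covered f a with adj⇒covered⊎covered e f a
    ... | inj₁ e∈C = ⊥-elim (e∉C e∈C)
    ... | inj₂ f∈C = f∈C

  ∣C∣<deg⇒covered : ∀ {e} → ∣ C ∣ < deg Gf e → T (covered e)
  ∣C∣<deg⇒covered {e} ∣C∣<deg with T? (covered e)
  ... | yes e∈C = e∈C
  ... | no  e∉C = ⊥-elim (<⇒≱ ∣C∣<deg (deg≤∣C∣ e∉C))

  module _ (P : Fin m → Bool) where

    coveredEdge : Fin m → Fin m → Bool
    coveredEdge i j = covered i ∧ P i ∧ adj i j

    -- Each edge {e, f} of G_f[P] with e < f is charged to an ordered pair
    -- starting at a covered endpoint, so no edge is counted twice.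
    edgesWithin≤oriented :
      edgesWithin Gf P ≤ ∑[ i < m ] ∑[ j < m ] (χ ((toℕ i <ᵇ toℕ j) ∧ coveredEdge i j)
                                               + χ ((toℕ j <ᵇ toℕ i) ∧ coveredEdge i j))
    edgesWithin≤oriented = begin
      edgesWithin Gf P
        ≡⟨ length-filterᵇ-cartesianProduct (isEdgeWithin Gf P) (λ i → i) (λ j → j) ⟩
      ∑[ e < m ] ∑[ f < m ] χ (lt e f ∧ P e ∧ P f ∧ adj e f)
        ≤⟨ sum-mono-≤ (λ e → sum-mono-≤ (λ f → charge e f)) ⟩
      ∑[ e < m ] ∑[ f < m ] (χ (lt e f ∧ coveredEdge e f) + χ (lt e f ∧ coveredEdge f e))
        ≡⟨ ∑∑-distrib-+ (λ e f → χ (lt e f ∧ coveredEdge e f)) (λ e f → χ (lt e f ∧ coveredEdge f e)) ⟩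
      ∑[ e < m ] ∑[ f < m ] χ (lt e f ∧ coveredEdge e f) + ∑[ e < m ] ∑[ f < m ] χ (lt e f ∧ coveredEdge f e)
        ≡⟨ cong (∑[ e < m ] ∑[ f < m ] χ (lt e f ∧ coveredEdge e f) +_) (∑-comm (λ e f → χ (lt e f ∧ coveredEdge f e))) ⟩
      ∑[ i < m ] ∑[ j < m ] χ (lt i j ∧ coveredEdge i j) + ∑[ i < m ] ∑[ j < m ] χ (lt j i ∧ coveredEdge i j)
        ≡⟨ sym (∑∑-distrib-+ (λ i j → χ (lt i j ∧ coveredEdge i j)) (λ i j → χ (lt j i ∧ coveredEdge i j))) ⟩
      ∑[ i < m ] ∑[ j < m ] (χ (lt i j ∧ coveredEdge i j) + χ (lt j i ∧ coveredEdge i j)) ∎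
      where
      open ≤-Reasoning
      lt : Fin m → Fin m → Bool
      lt i j = toℕ i <ᵇ toℕ j
      charge : ∀ e f → χ (lt e f ∧ P e ∧ P f ∧ adj e f)
                       ≤ χ (lt e f ∧ coveredEdge e f) + χ (lt e f ∧ coveredEdge f e)
      charge e f = subst (λ a → χ (lt e f ∧ P e ∧ P f ∧ adj e f)
                                 ≤ χ (lt e f ∧ coveredEdge e f) + χ (lt e f ∧ covered f ∧ P f ∧ a))
                         (symm e f)
                         (χ-charge (lt e f) (P e) (P f) (adj⇒covered⊎covered e f))
      ∑∑-distrib-+ : (g h : Fin m → Fin m → ℕ) →
                     ∑[ i < m ] ∑[ j < m ] (g i j + h i j) ≡ ∑[ i < m ] ∑[ j < m ] g i j + ∑[ i < m ] ∑[ j < m ] h i j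
      ∑∑-distrib-+ g h = trans (sum-cong-≗ (λ i → ∑-distrib-+ (g i) (h i)))
                               (∑-distrib-+ (λ i → ∑[ j < m ] g i j) (λ i → ∑[ j < m ] h i j))

    ∑coveredEdge≤ : ∀ d → (∀ e → T (P e) → deg Gf e ≤ d) →
                    ∑[ i < m ] ∑[ j < m ] χ (coveredEdge i j) ≤ ∣ C ∣ * d
    ∑coveredEdge≤ d low = begin
      ∑[ i < m ] ∑[ j < m ] χ (coveredEdge i j)
        ≡⟨ sum-cong-≗ (λ i → trans (∑-χ-∧ (covered i) (λ j → P i ∧ adj i j)) (cong (χ (covered i) *_) (∑-χ-∧ (P i) (adj i)))) ⟩
      ∑[ i < m ] (χ (covered i) * (χ (P i) * ∑[ j < m ] χ (adj i j)))
        ≤⟨ sum-mono-≤ (λ i → *-monoʳ-≤ (χ (covered i)) (χ-*-≤ (λ Pi → ≤-trans (≤-reflexive (sym (deg≡∑χ i))) (low i Pi)))) ⟩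
      ∑[ i < m ] (χ (covered i) * d)
        ≡⟨ sym (*-distribʳ-sum d (χ ∘ covered)) ⟩
      ∑[ i < m ] χ (covered i) * d
        ≡⟨ cong (_* d) (sym (∣∣≡∑χ C)) ⟩
      ∣ C ∣ * d ∎
      where open ≤-Reasoning

    edgesWithin≤ : ∀ d → (∀ e → T (P e) → deg Gf e ≤ d) → edgesWithin Gf P ≤ ∣ C ∣ * d
    edgesWithin≤ d low = begin
      edgesWithin Gf P
        ≤⟨ edgesWithin≤oriented ⟩
      ∑[ i < m ] ∑[ j < m ] (χ ((toℕ i <ᵇ toℕ j) ∧ coveredEdge i j) + χ ((toℕ j <ᵇ toℕ i) ∧ coveredEdge i j))
        ≤⟨ sum-mono-≤ (λ i → sum-mono-≤ (λ j → χ-∧-disjoint (coveredEdge i j) (<ᵇ-asym (toℕ i) (toℕ j)))) ⟩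
      ∑[ i < m ] ∑[ j < m ] χ (coveredEdge i j)
        ≤⟨ ∑coveredEdge≤ d low ⟩
      ∣ C ∣ * d ∎
      where
      open ≤-Reasoning
      <ᵇ-asym : ∀ x y → T (x <ᵇ y) → T (y <ᵇ x) → ⊥
      <ᵇ-asym x y x<y y<x = <-asym (<ᵇ⇒< x y x<y) (<ᵇ⇒< y x y<x)

  module _ {k : ℕ} (∣C∣≤k : ∣ C ∣ ≤ k) where

    sizeH≤k : sizeH Gf k ≤ k
    sizeH≤k = begin
      sizeH Gf k                    ≡⟨ length-filterᵇ-tabulate (inH Gf k) (λ e → e) ⟩
      ∑[ e < m ] χ (inH Gf k e)     ≤⟨ sum-mono-≤ (λ e → χ-mono (H⊆C e)) ⟩
      ∑[ e < m ] χ (covered e)      ≡⟨ sym (∣∣≡∑χ C) ⟩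
      ∣ C ∣                         ≤⟨ ∣C∣≤k ⟩
      k                             ∎
      where
      open ≤-Reasoning
      H⊆C : ∀ e → T (inH Gf k e) → T (covered e)
      H⊆C e e∈H = ∣C∣<deg⇒covered (≤-<-trans ∣C∣≤k (<ᵇ⇒< k (deg Gf e) e∈H))

    edgesR≤k*k : edgesR Gf k ≤ k * k
    edgesR≤k*k = ≤-trans (edgesWithin≤ (inR Gf k) k (inR⇒deg≤ Gf k)) (*-monoˡ-≤ k ∣C∣≤k)

lemma3 : ∀ {n m} (G : SimpleGraph n m) (Gf : ForcingGraph m) (s t : Fin n) (k : ℕ)
         → s ≢ t → 1 ≤ k
         → YesInstance G Gf s t k
         → sizeH Gf k ≤ k × edgesR Gf k ≤ k * k
lemma3 G Gf s t k _ _ (C , ∣C∣≤k , _ , cover) = sizeH≤k Gf cover ∣C∣≤k , edgesR≤k*k Gf cover ∣C∣≤k
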